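{- Let $H=(V,\mathcal F)$ be a hypergraph with $m=|\mathcal F|$ and $k$ an integer, such that none of the following reduction rules applies to $(H,k)$: (Rule 1) there exist distinct edges $e,e'\in\mathcal F$ with $e\subseteq e'$; (Rule 2) there exist distinct vertices $u,v\in V$ with $\mathcal F[u]\subseteq\mathcal F[v]$; (Rule 3) there exist $v\in V$ and $e\in\mathcal F$ with $\mathcal F[v]=\{e\}$ and $e=\{v\}$. Let $S^*$ be the set produced by the following greedy procedure: start with $S^*=\emptyset$; while $|\mathcal F[S^*]|<|S^*|+k$ and there is $v\in V$ with $|\mathcal F[v]\setminus\mathcal F[S^*]|>1$, pick a vertex $v$ maximizing $|\mathcal F[v]\setminus\mathcal F[S^*]|$ and add it to $S^*$. Assume $S^*$ is not a mini-hitting set, and let $\mathcal C=\mathcal F[S^*]$. For $\mathcal C'\subseteq\mathcal C$ let $V(\mathcal C')=\{v\in V:\mathcal C[v]=\mathcal C'\}$. Suppose that for some $\mathcal C'\subseteq\mathcal C$ we have $|V(\mathcal C')|>k$, and let $v\in V(\mathcal C')$. Then $H-v$ has a hitting set of size at most $m-k$ if and only if $H$ has a hitting set of size at most $m-k$ (i.e. $(H-v,k)$ is a Yes-instance of HS$(m-k,k)$ if and only if $(H,k)$ is).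
   Context: A hypergraph $H=(V,\mathcal F)$ consists of a nonempty vertex set $V$ and a family $\mathcal F$ of nonempty subsets of $V$ (edges), parallel edges allowed. For $v\in V$ and $\mathcal E\subseteq\mathcal F$, $\mathcal E[v]$ is the set of edges of $\mathcal E$ containing $v$; for $T\subseteq V$, $\mathcal F[T]=\bigcup_{v\in T}\mathcal F[v]$. $H-v$ has vertex set $V\setminus\{v\}$ and edges $\{e\setminus\{v\}:e\in\mathcal F\}$ (so it has the same number $m$ of edges). A hitting set is a set of vertices meeting every edge. A mini-hitting set (with respect to $k$) is a set $S\subseteq V$ with $|S|\le k$ and $|\mathcal F[S]|\ge|S|+k$. HS$(m-k,k)$: given hypergraph $H$ with $m$ edges and integer $k$ (parameter), decide whether $H$ has a hitting set of size at most $m-k$. -}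

module Defs where

open import Data.Nat using (ℕ; suc; _≤_; _<_)
open import Data.Integer as ℤ using (ℤ; +_)
open import Data.Bool using (Bool)
open import Data.Fin using (Fin; punchIn)
open import Data.Fin.Subset using (Subset; _∈_; _⊆_; _∩_; _∪_; _─_; ⁅_⁆; ∣_∣; Nonempty; ⊥)
open import Data.Fin.Subset.Properties using (nonempty?)
open import Data.Vec using (tabulate; lookup)
open import Data.Vec.Properties using (≡-dec)
open import Data.Bool.Properties using () renaming (_≟_ to _≟ᵇ_)
open import Data.Product using (Σ; ∃; ∃₂; _×_)
open import Relation.Nullary using (¬_; does)
open import Relation.Binary.PropositionalEquality using (_≡_; _≢_)

-- A (raw) hypergraph on vertex set Fin n with m edges (indexed by Fin m,
-- so parallel edges are allowed); each edge is a subset of the vertices.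
Edges : ℕ → ℕ → Set
Edges n m = Fin m → Subset n

IsHypergraph : ∀ {n m} → Edges n m → Set
IsHypergraph {n} {m} E = (0 < n) × (∀ (j : Fin m) → Nonempty (E j))

inc : ∀ {n m} → Edges n m → Fin n → Subset m
inc E v = tabulate λ j → lookup (E j) v

incSet : ∀ {n m} → Edges n m → Subset n → Subset m
incSet E T = tabulate λ j → does (nonempty? (E j ∩ T))

Rule1 : ∀ {n m} → Edges n m → Set
Rule1 E = ∃₂ λ e e' → e ≢ e' × E e ⊆ E e'

Rule2 : ∀ {n m} → Edges n m → Set
Rule2 E = ∃₂ λ u v → u ≢ v × inc E u ⊆ inc E v

Rule3 : ∀ {n m} → Edges n m → Set
Rule3 E = ∃₂ λ v e → inc E v ≡ ⁅ e ⁆ × E e ≡ ⁅ v ⁆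

gain : ∀ {n m} → Edges n m → Subset n → Fin n → ℕ
gain E S v = ∣ inc E v ─ incSet E S ∣

Guard : ∀ {n m} → Edges n m → ℤ → Subset n → Set
Guard E k S = (+ ∣ incSet E S ∣ ℤ.< + ∣ S ∣ ℤ.+ k) × ∃ λ w → 1 < gain E S w

-- S is a state reachable by the greedy procedure (any tie-breaking)
data GreedyReach {n m} (E : Edges n m) (k : ℤ) : Subset n → Set where
  start : GreedyReach E k ⊥
  step  : ∀ {S} v → GreedyReach E k S → Guard E k S →
          (∀ w → gain E S w ≤ gain E S v) →
          GreedyReach E k (S ∪ ⁅ v ⁆)

GreedyOutput : ∀ {n m} → Edges n m → ℤ → Subset n → Set
GreedyOutput E k S = GreedyReach E k S × ¬ Guard E k S

MiniHittingSet : ∀ {n m} → Edges n m → ℤ → Subset n → Set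
MiniHittingSet E k S = (+ ∣ S ∣ ℤ.≤ k) × (+ ∣ S ∣ ℤ.+ k ℤ.≤ + ∣ incSet E S ∣)

VOf : ∀ {n m} → Edges n m → Subset m → Subset m → Subset n
VOf E C C' = tabulate λ v → does (≡-dec _≟ᵇ_ (inc E v ∩ C) C')

HittingSet : ∀ {n m} → Edges n m → Subset n → Set
HittingSet {m = m} E S = ∀ (j : Fin m) → Nonempty (E j ∩ S)

HSYes : ∀ {n m} → Edges n m → ℤ → Set
HSYes {n} {m} E k = ∃ λ (S : Subset n) → HittingSet E S × (+ ∣ S ∣ ℤ.≤ + m ℤ.- k)

-- H - v : vertex set V \ {v} (re-indexed via punchIn), edges e \ {v}
deleteV : ∀ {n m} → Edges (suc n) m → Fin (suc n) → Edges n m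
deleteV E v j = tabulate λ i → lookup (E j) (punchIn v i)

module Submission where

-- Write F[S] for the edges met by S and say S has excess K when |S| + K ≤ |F[S]|.
-- A hitting set of size ≤ m - K has excess K, and conversely a set of excess K
-- extends, by one vertex for every missed edge, to a hitting set of size ≤ m - K;
-- so (H, K) is a Yes-instance iff some set has excess K.
--
-- The direction H - v ⇒ H is immediate: a hitting set of H - v is one of H.
-- For H ⇒ H - v with k = K ≥ 0 we turn a set of excess K into one avoiding v:
--   * module Minimal: an inclusion-minimal set of excess K has at most K vertices,
--     since each of its vertices has two private edges;
--   * module Greedy: as the greedy output S* is not a mini-hitting set, every
--     vertex has at most one edge outside C = F[S*];
--   * module Exchange: by Rule 2 the vertices of V(C') are told apart by their
--     outside edge, so |V(C')| > K lets us trade v for another vertex of V(C')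
--     without losing edges.
-- Module Deletion shows that such a set keeps its excess in H - v, whose edges
-- stay nonempty by Rules 1 and 3.  For k < 0, H - v is trivially a Yes-instance.

open import Defs
open import Data.Nat using (ℕ; zero; suc; _+_; _∸_; _≤_; _<_; z≤n; s≤s; _≤?_)
import Data.Nat.Properties as ℕP
open import Data.Integer as ℤ using (ℤ; -[1+_])
import Data.Integer.Properties as ℤP
open import Data.Bool using (Bool; true)
open import Data.Bool.Properties using () renaming (_≟_ to _≟ᵇ_)
open import Data.Fin using (Fin; zero; suc; punchIn; punchOut; _≟_)
open import Data.Fin.Properties using (any?; suc-injective; 0≢1+n; punchIn-punchOut; punchIn-injective)
open import Data.Fin.Subset
  using (Subset; inside; outside; _∈_; _∉_; _⊆_; _∩_; _∪_; _─_; _-_; ⁅_⁆; ∣_∣; Nonempty; ⊥; ⊤)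
open import Data.Fin.Subset.Properties
  using ( _∈?_; nonempty?; Empty-unique; ⊆-antisym; p⊆q⇒∣p∣≤∣q∣; ∣⊥∣≡0; ∣⊤∣≡n; ∣⁅x⁆∣≡1
        ; x∈⁅x⁆; x∈⁅y⁆⇒x≡y; x∈p∩q⁺; x∈p∩q⁻; x∈p∪q⁺; x∈p∪q⁻; ∣q∣≤∣p∪q∣; p─q⊆p
        ; ∣p─q∣≤∣p∣; x∈p∧x∉q⇒x∈p─q; x∈p∧x≢y⇒x∈p-y; p─x─y≡p─y─x; x∈p⇒∣p-x∣<∣p∣
        ; x∉p⇒x∈∁p; ∣∁p∣≡n∸∣p∣; ∣p∣≤n)
open import Data.Vec using ([]; _∷_; tabulate; lookup; insertAt; here; there)
open import Data.Vec.Properties using (lookup∘tabulate; []=⇒lookup; lookup⇒[]=; insertAt-punchIn; ≡-dec)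
open import Data.Product using (∃; _×_; _,_; proj₁; proj₂)
open import Data.Sum using (inj₁; inj₂)
open import Data.Empty using (⊥-elim)
open import Function using (_∘_)
open import Function.Bundles using (_⇔_; mk⇔; Equivalence)
open import Relation.Nullary using (¬_; Dec; yes; no; does; contradiction)
open import Relation.Nullary.Decidable using (dec-true; _×-dec_; ¬?)
open import Relation.Binary.PropositionalEquality using (_≡_; _≢_; refl; sym; trans; cong; subst)

does-true⇒ : ∀ {p} {P : Set p} (P? : Dec P) → does P? ≡ true → P
does-true⇒ (yes p) _ = p
does-true⇒ (no _) ()

∈-tabulate⁺ : ∀ {n} (f : Fin n → Bool) {x} → f x ≡ true → x ∈ tabulate f
∈-tabulate⁺ f {x} fx≡true = lookup⇒[]= x (tabulate f) (trans (lookup∘tabulate f x) fx≡true)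

∈-tabulate⁻ : ∀ {n} (f : Fin n → Bool) {x} → x ∈ tabulate f → f x ≡ true
∈-tabulate⁻ f {x} x∈ = trans (sym (lookup∘tabulate f x)) ([]=⇒lookup x∈)

x∈p─q⇒x∉q : ∀ {n} {x : Fin n} (p q : Subset n) → x ∈ p ─ q → x ∉ q
x∈p─q⇒x∉q (_ ∷ p) (_ ∷ q) (there x∈p─q) (there x∈q) = x∈p─q⇒x∉q p q x∈p─q x∈q

∣p∪q∣≡∣p∣+∣q─p∣ : ∀ {n} (p q : Subset n) → ∣ p ∪ q ∣ ≡ ∣ p ∣ + ∣ q ─ p ∣
∣p∪q∣≡∣p∣+∣q─p∣ []            []            = refl
∣p∪q∣≡∣p∣+∣q─p∣ (inside ∷ p)  (_ ∷ q)       = cong suc (∣p∪q∣≡∣p∣+∣q─p∣ p q)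
∣p∪q∣≡∣p∣+∣q─p∣ (outside ∷ p) (inside ∷ q)  =
  trans (cong suc (∣p∪q∣≡∣p∣+∣q─p∣ p q)) (sym (ℕP.+-suc (∣ p ∣) (∣ q ─ p ∣)))
∣p∪q∣≡∣p∣+∣q─p∣ (outside ∷ p) (outside ∷ q) = ∣p∪q∣≡∣p∣+∣q─p∣ p q

∣q∣≤∣p∣+∣q─p∣ : ∀ {n} (p q : Subset n) → ∣ q ∣ ≤ ∣ p ∣ + ∣ q ─ p ∣
∣q∣≤∣p∣+∣q─p∣ p q = subst (∣ q ∣ ≤_) (∣p∪q∣≡∣p∣+∣q─p∣ p q) (∣q∣≤∣p∪q∣ p q)

∣p∣+∣q─p∣≤∣r∣ : ∀ {n} {p q r : Subset n} → p ⊆ r → q ⊆ r → ∣ p ∣ + ∣ q ─ p ∣ ≤ ∣ r ∣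
∣p∣+∣q─p∣≤∣r∣ {p = p} {q} p⊆r q⊆r =
  subst (_≤ _) (∣p∪q∣≡∣p∣+∣q─p∣ p q) (p⊆q⇒∣p∣≤∣q∣ p∪q⊆r)
  where
  p∪q⊆r : p ∪ q ⊆ _
  p∪q⊆r x∈p∪q with x∈p∪q⁻ p q x∈p∪q
  ... | inj₁ x∈p = p⊆r x∈p
  ... | inj₂ x∈q = q⊆r x∈q

∣p∪⁅x⁆∣≤1+∣p∣ : ∀ {n} (p : Subset n) x → ∣ p ∪ ⁅ x ⁆ ∣ ≤ suc ∣ p ∣
∣p∪⁅x⁆∣≤1+∣p∣ p x = begin
  ∣ p ∪ ⁅ x ⁆ ∣          ≡⟨ ∣p∪q∣≡∣p∣+∣q─p∣ p ⁅ x ⁆ ⟩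
  ∣ p ∣ + ∣ ⁅ x ⁆ ─ p ∣  ≤⟨ ℕP.+-monoʳ-≤ ∣ p ∣ (∣p─q∣≤∣p∣ ⁅ x ⁆ p) ⟩
  ∣ p ∣ + ∣ ⁅ x ⁆ ∣      ≡⟨ cong (∣ p ∣ +_) (∣⁅x⁆∣≡1 x) ⟩
  ∣ p ∣ + 1              ≡⟨ ℕP.+-comm ∣ p ∣ 1 ⟩
  suc ∣ p ∣              ∎
  where open ℕP.≤-Reasoning

∣p∣≡1+∣p-x∣ : ∀ {n} {p : Subset n} {x} → x ∈ p → ∣ p ∣ ≡ suc ∣ p - x ∣
∣p∣≡1+∣p-x∣ {p = p} {x} x∈p = ℕP.≤-antisym
  (subst (λ c → ∣ p ∣ ≤ c + ∣ p - x ∣) (∣⁅x⁆∣≡1 x) (∣q∣≤∣p∣+∣q─p∣ ⁅ x ⁆ p))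
  (x∈p⇒∣p-x∣<∣p∣ x∈p)

injection-≤ : ∀ {a b} (A : Subset a) (B : Subset b) (f : ∀ x → x ∈ A → Fin b) →
              (∀ x x∈A → f x x∈A ∈ B) →
              (∀ x y x∈A y∈A → f x x∈A ≡ f y y∈A → x ≡ y) → ∣ A ∣ ≤ ∣ B ∣
injection-≤ [] B f f∈B f-inj = z≤n
injection-≤ (outside ∷ A) B f f∈B f-inj =
  injection-≤ A B (λ x x∈A → f (suc x) (there x∈A)) (λ x x∈A → f∈B (suc x) (there x∈A))
    (λ x y x∈A y∈A eq → suc-injective (f-inj (suc x) (suc y) (there x∈A) (there y∈A) eq))
injection-≤ (inside ∷ A) B f f∈B f-inj = begin
  suc ∣ A ∣       ≤⟨ s≤s (injection-≤ A (B - f zero here) f′ f′∈B-f₀ f′-inj) ⟩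
  suc ∣ B - f zero here ∣  ≡⟨ sym (∣p∣≡1+∣p-x∣ (f∈B zero here)) ⟩
  ∣ B ∣           ∎
  where
  open ℕP.≤-Reasoning
  f′ : ∀ x → x ∈ A → Fin _
  f′ x x∈A = f (suc x) (there x∈A)
  f′∈B-f₀ : ∀ x x∈A → f′ x x∈A ∈ B - f zero here
  f′∈B-f₀ x x∈A = x∈p∧x≢y⇒x∈p-y (f∈B (suc x) (there x∈A))
                    (λ eq → 0≢1+n (sym (f-inj (suc x) zero (there x∈A) here eq)))
  f′-inj : ∀ x y x∈A y∈A → f′ x x∈A ≡ f′ y y∈A → x ≡ y
  f′-inj x y x∈A y∈A eq = suc-injective (f-inj (suc x) (suc y) (there x∈A) (there y∈A) eq)

∣p∣≤1⇒unique : ∀ {n} (A : Subset n) {a b : Fin n} → ∣ A ∣ ≤ 1 → a ∈ A → b ∈ A → a ≡ b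
∣p∣≤1⇒unique A {a} {b} ∣A∣≤1 a∈A b∈A with a ≟ b
... | yes a≡b = a≡b
... | no a≢b  = contradiction ∣A∣≤1 (ℕP.<⇒≱ 1<∣A∣)
  where
  1<∣A∣ : 1 < ∣ A ∣
  1<∣A∣ rewrite ∣p∣≡1+∣p-x∣ a∈A | ∣p∣≡1+∣p-x∣ (x∈p∧x≢y⇒x∈p-y b∈A (a≢b ∘ sym)) = s≤s (s≤s z≤n)

∣insertAt-outside∣ : ∀ {n} (T : Subset n) v → ∣ insertAt T v outside ∣ ≡ ∣ T ∣
∣insertAt-outside∣ T             zero    = refl
∣insertAt-outside∣ (inside ∷ T)  (suc v) = cong suc (∣insertAt-outside∣ T v)
∣insertAt-outside∣ (outside ∷ T) (suc v) = ∣insertAt-outside∣ T v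

module _ {n m : ℕ} (E : Edges n m) where

  ∈-inc⁺ : ∀ {x j} → x ∈ E j → j ∈ inc E x
  ∈-inc⁺ {x} {j} x∈Ej = ∈-tabulate⁺ _ ([]=⇒lookup x∈Ej)

  ∈-inc⁻ : ∀ {x j} → j ∈ inc E x → x ∈ E j
  ∈-inc⁻ {x} {j} j∈ = lookup⇒[]= x (E j) (∈-tabulate⁻ _ j∈)

  ∈-incSet⁺ : ∀ {T j x} → x ∈ E j → x ∈ T → j ∈ incSet E T
  ∈-incSet⁺ {T} {j} {x} x∈Ej x∈T =
    ∈-tabulate⁺ _ (dec-true (nonempty? (E j ∩ T)) (x , x∈p∩q⁺ (x∈Ej , x∈T)))

  ∈-incSet⁻ : ∀ {T j} → j ∈ incSet E T → ∃ λ x → x ∈ E j × x ∈ T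
  ∈-incSet⁻ {T} {j} j∈ with does-true⇒ (nonempty? (E j ∩ T)) (∈-tabulate⁻ _ j∈)
  ... | x , x∈Ej∩T = x , x∈p∩q⁻ (E j) T x∈Ej∩T

  incSet-mono : ∀ {A B} → A ⊆ B → incSet E A ⊆ incSet E B
  incSet-mono A⊆B j∈ with ∈-incSet⁻ j∈
  ... | x , x∈Ej , x∈A = ∈-incSet⁺ x∈Ej (A⊆B x∈A)

  VOf⇒ : ∀ {C C' u} → u ∈ VOf E C C' → inc E u ∩ C ≡ C'
  VOf⇒ {C} {C'} {u} u∈V = does-true⇒ (≡-dec _≟ᵇ_ (inc E u ∩ C) C') (∈-tabulate⁻ _ u∈V)

HasExcess : ∀ {n m} → Edges n m → ℕ → Subset n → Set
HasExcess E K S = ∣ S ∣ + K ≤ ∣ incSet E S ∣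

module _ {n m : ℕ} (E : Edges n m) where

  hitting⇒meets-all : ∀ {T} → HittingSet E T → m ≤ ∣ incSet E T ∣
  hitting⇒meets-all {T} hit = subst (_≤ ∣ incSet E T ∣) (∣⊤∣≡n m) (p⊆q⇒∣p∣≤∣q∣ ⊤⊆F[T])
    where
    ⊤⊆F[T] : ⊤ ⊆ incSet E T
    ⊤⊆F[T] {j} _ with x∈p∩q⁻ (E j) T (proj₂ (hit j))
    ... | x∈Ej , x∈T = ∈-incSet⁺ E x∈Ej x∈T

  extend-to-hitting : (∀ j → Nonempty (E j)) → ∀ S →
                      ∃ λ T → HittingSet E T × ∣ T ∣ + ∣ incSet E S ∣ ≤ ∣ S ∣ + m
  extend-to-hitting nonempty S = S ∪ U , hit , bound
    where
    open ℕP.≤-Reasoning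
    F[S] = incSet E S
    pick : Fin m → Fin n
    pick j = proj₁ (nonempty j)
    Picks? : ∀ x j → Dec (j ∉ F[S] × pick j ≡ x)
    Picks? x j = ¬? (j ∈? F[S]) ×-dec (pick j ≟ x)
    U : Subset n
    U = tabulate λ x → does (any? (Picks? x))
    ∈U⁻ : ∀ {x} → x ∈ U → ∃ λ j → j ∉ F[S] × pick j ≡ x
    ∈U⁻ {x} x∈U = does-true⇒ (any? (Picks? x)) (∈-tabulate⁻ _ x∈U)
    ∣U∣≤ : ∣ U ∣ ≤ m ∸ ∣ F[S] ∣
    ∣U∣≤ = subst (∣ U ∣ ≤_) (∣∁p∣≡n∸∣p∣ F[S])
      (injection-≤ U _ (λ x x∈U → proj₁ (∈U⁻ x∈U)) (λ x x∈U → x∉p⇒x∈∁p (proj₁ (proj₂ (∈U⁻ x∈U))))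
        (λ x y x∈U y∈U eq → trans (sym (proj₂ (proj₂ (∈U⁻ x∈U))))
                                  (trans (cong pick eq) (proj₂ (proj₂ (∈U⁻ y∈U))))))
    hit : HittingSet E (S ∪ U)
    hit j with j ∈? F[S]
    ... | yes j∈F[S] = let x , x∈Ej , x∈S = ∈-incSet⁻ E j∈F[S]
                       in x , x∈p∩q⁺ (x∈Ej , x∈p∪q⁺ (inj₁ x∈S))
    ... | no j∉F[S]  = pick j , x∈p∩q⁺ (proj₂ (nonempty j) , x∈p∪q⁺ (inj₂ pick∈U))
      where pick∈U = ∈-tabulate⁺ _ (dec-true (any? (Picks? (pick j))) (j , j∉F[S] , refl))
    bound : ∣ S ∪ U ∣ + ∣ F[S] ∣ ≤ ∣ S ∣ + m
    bound = begin
      ∣ S ∪ U ∣ + ∣ F[S] ∣                   ≡⟨ cong (_+ ∣ F[S] ∣) (∣p∪q∣≡∣p∣+∣q─p∣ S U) ⟩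
      ∣ S ∣ + ∣ U ─ S ∣ + ∣ F[S] ∣           ≤⟨ ℕP.+-monoˡ-≤ (∣ F[S] ∣) (ℕP.+-monoʳ-≤ (∣ S ∣)
                                                   (ℕP.≤-trans (∣p─q∣≤∣p∣ U S) ∣U∣≤)) ⟩
      ∣ S ∣ + (m ∸ ∣ F[S] ∣) + ∣ F[S] ∣      ≡⟨ ℕP.+-assoc (∣ S ∣) _ (∣ F[S] ∣) ⟩
      ∣ S ∣ + (m ∸ ∣ F[S] ∣ + ∣ F[S] ∣)      ≡⟨ cong (∣ S ∣ +_) (ℕP.m∸n+n≡m (∣p∣≤n F[S])) ⟩
      ∣ S ∣ + m                              ∎

  hitting⇒excess : ∀ {T} K → HittingSet E T → ∣ T ∣ + K ≤ m → HasExcess E K T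
  hitting⇒excess K hit ∣T∣+K≤m = ℕP.≤-trans ∣T∣+K≤m (hitting⇒meets-all hit)

  excess⇒hitting : (∀ j → Nonempty (E j)) → ∀ {S} K → HasExcess E K S →
                   ∃ λ T → HittingSet E T × ∣ T ∣ + K ≤ m
  excess⇒hitting nonempty {S} K excess with extend-to-hitting nonempty S
  ... | T , hit , bound = T , hit , ℕP.+-cancelˡ-≤ (∣ S ∣) _ _ (begin
    ∣ S ∣ + (∣ T ∣ + K)     ≡⟨ ℕP.+-comm (∣ S ∣) _ ⟩
    (∣ T ∣ + K) + ∣ S ∣     ≡⟨ ℕP.+-assoc (∣ T ∣) K (∣ S ∣) ⟩
    ∣ T ∣ + (K + ∣ S ∣)     ≡⟨ cong (∣ T ∣ +_) (ℕP.+-comm K (∣ S ∣)) ⟩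
    ∣ T ∣ + (∣ S ∣ + K)     ≤⟨ ℕP.+-monoʳ-≤ ∣ T ∣ excess ⟩
    ∣ T ∣ + ∣ incSet E S ∣  ≤⟨ bound ⟩
    ∣ S ∣ + m               ∎)
    where open ℕP.≤-Reasoning

budget⇔ : ∀ a m K → (ℤ.+ a ℤ.≤ ℤ.+ m ℤ.- ℤ.+ K) ⇔ (a + K ≤ m)
budget⇔ a m K with K ≤? m
... | yes K≤m rewrite ℤP.[+m]-[+n]≡m⊖n m K | ℤP.⊖-≥ K≤m =
  mk⇔ (λ { (ℤ.+≤+ a≤m∸K) → ℕP.m≤o∸n⇒m+n≤o a K≤m a≤m∸K })
      (λ a+K≤m → ℤ.+≤+ (ℕP.m+n≤o⇒m≤o∸n a a+K≤m))
... | no K≰m = mk⇔ (λ a≤m-K → below-negative (subst (ℤ.+ a ℤ.≤_) m-K≡ a≤m-K))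
                   (λ a+K≤m → contradiction (ℕP.≤-trans (ℕP.m≤n+m K a) a+K≤m) K≰m)
  where
  m-K≡ : ℤ.+ m ℤ.- ℤ.+ K ≡ ℤ.- (ℤ.+ (K ∸ m))
  m-K≡ = trans (ℤP.[+m]-[+n]≡m⊖n m K) (ℤP.⊖-≰ K≰m)
  -- here m - K is negative, so no natural number lies below it
  below-negative : ℤ.+ a ℤ.≤ ℤ.- (ℤ.+ (K ∸ m)) → a + K ≤ m
  below-negative a≤ with K ∸ m | ℕP.m<n⇒0<n∸m (ℕP.≰⇒> K≰m)
  below-negative () | suc _ | _

HSYes-antitone : ∀ {n m} (E : Edges n m) {k k'} → HSYes E k → k' ℤ.≤ k → HSYes E k'
HSYes-antitone E {k} {k'} (T , hit , ∣T∣≤m-k) k'≤k =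
  T , hit , ℤP.≤-trans ∣T∣≤m-k (ℤP.+-monoʳ-≤ (ℤ.+ _) (ℤP.neg-mono-≤ k'≤k))

module Minimal {n m : ℕ} (E : Edges n m) (K : ℕ) where

  private
    F : Subset n → Subset m
    F = incSet E

  Private : Subset n → Fin n → Subset m
  Private T w = F T ─ F (T - w)

  ∣F∣-split : ∀ T w → ∣ F T ∣ ≡ ∣ F (T - w) ∣ + ∣ Private T w ∣
  ∣F∣-split T w = ℕP.≤-antisym (∣q∣≤∣p∣+∣q─p∣ (F (T - w)) (F T))
                                (∣p∣+∣q─p∣≤∣r∣ (incSet-mono E (p─q⊆p T ⁅ w ⁆)) (λ j∈ → j∈))

  Private-mono : ∀ T {x w} → w ∈ T - x → Private T w ⊆ Private (T - x) w
  Private-mono T {x} {w} w∈T-x {j} j∈P with ∈-incSet⁻ E (p─q⊆p (F T) _ j∈P)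
  ... | y , y∈Ej , y∈T with y ≟ w
  ...   | no y≢w   = contradiction (∈-incSet⁺ E y∈Ej (x∈p∧x≢y⇒x∈p-y y∈T y≢w)) (x∈p─q⇒x∉q _ _ j∈P)
  ...   | yes refl = x∈p∧x∉q⇒x∈p─q (∈-incSet⁺ E y∈Ej w∈T-x)
                       (x∈p─q⇒x∉q _ _ j∈P ∘ incSet-mono E T-x-w⊆T-w)
    where
    T-x-w⊆T-w : T - x - w ⊆ T - w
    T-x-w⊆T-w z∈ = p─q⊆p (T - w) ⁅ x ⁆ (subst (_ ∈_) (p─x─y≡p─y─x T x w) z∈)

  doubling : ∀ T → (∀ w → w ∈ T → 2 ≤ ∣ Private T w ∣) → ∣ T ∣ + ∣ T ∣ ≤ ∣ F T ∣
  doubling T = go ∣ T ∣ T refl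
    where
    open ℕP.≤-Reasoning
    go : ∀ N T → ∣ T ∣ ≡ N → (∀ w → w ∈ T → 2 ≤ ∣ Private T w ∣) → ∣ T ∣ + ∣ T ∣ ≤ ∣ F T ∣
    go zero T ∣T∣≡0 _ rewrite ∣T∣≡0 = z≤n
    go (suc N) T ∣T∣≡1+N two-private with nonempty? T
    ... | no empty = ⊥-elim (ℕP.0≢1+n (trans (sym (∣⊥∣≡0 n))
                                (subst (λ U → ∣ U ∣ ≡ suc N) (Empty-unique empty) ∣T∣≡1+N)))
    ... | yes (x , x∈T) = begin
      ∣ T ∣ + ∣ T ∣                            ≡⟨ cong (λ c → c + c) (∣p∣≡1+∣p-x∣ x∈T) ⟩
      suc ∣ T - x ∣ + suc ∣ T - x ∣            ≡⟨ cong suc (ℕP.+-suc (∣ T - x ∣) (∣ T - x ∣)) ⟩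
      2 + (∣ T - x ∣ + ∣ T - x ∣)              ≤⟨ ℕP.+-mono-≤ (two-private x x∈T) smaller ⟩
      ∣ Private T x ∣ + ∣ F (T - x) ∣          ≡⟨ ℕP.+-comm _ (∣ F (T - x) ∣) ⟩
      ∣ F (T - x) ∣ + ∣ Private T x ∣          ≡⟨ ∣F∣-split T x ⟨
      ∣ F T ∣                                  ∎
      where
      smaller : ∣ T - x ∣ + ∣ T - x ∣ ≤ ∣ F (T - x) ∣
      smaller = go N (T - x) (ℕP.suc-injective (trans (sym (∣p∣≡1+∣p-x∣ x∈T)) ∣T∣≡1+N))
        (λ w w∈T-x → ℕP.≤-trans (two-private w (p─q⊆p T ⁅ x ⁆ w∈T-x))
                                 (p⊆q⇒∣p∣≤∣q∣ (Private-mono T w∈T-x)))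

  IsMinimal : Subset n → Set
  IsMinimal S = ∀ x → x ∈ S → ¬ HasExcess E K (S - x)

  minimal⇒two-private : ∀ S → HasExcess E K S → IsMinimal S → ∀ w → w ∈ S → 2 ≤ ∣ Private S w ∣
  minimal⇒two-private S excess minimal w w∈S = ℕP.+-cancelˡ-≤ (∣ F (S - w) ∣) 2 _ (begin
    ∣ F (S - w) ∣ + 2                    ≡⟨ ℕP.+-comm (∣ F (S - w) ∣) 2 ⟩
    suc (suc ∣ F (S - w) ∣)              ≤⟨ s≤s (ℕP.≰⇒> (minimal w w∈S)) ⟩
    suc ∣ S - w ∣ + K                    ≡⟨ cong (_+ K) (∣p∣≡1+∣p-x∣ w∈S) ⟨
    ∣ S ∣ + K                            ≤⟨ excess ⟩
    ∣ F S ∣                              ≡⟨ ∣F∣-split S w ⟩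
    ∣ F (S - w) ∣ + ∣ Private S w ∣      ∎)
    where open ℕP.≤-Reasoning

  -- A nonempty minimal set of excess K has at most K vertices: S - v meets at
  -- least 2|S - v| but fewer than |S - v| + K edges.
  minimal⇒size≤K : ∀ S {v} → HasExcess E K S → IsMinimal S → v ∈ S → ∣ S ∣ ≤ K
  minimal⇒size≤K S {v} excess minimal v∈S =
    subst (_≤ K) (sym (∣p∣≡1+∣p-x∣ v∈S))
      (ℕP.+-cancelˡ-< (∣ S - v ∣) _ _ (ℕP.≤-<-trans (doubling (S - v) two-private) (ℕP.≰⇒> (minimal v v∈S))))
    where
    two-private : ∀ w → w ∈ S - v → 2 ≤ ∣ Private (S - v) w ∣
    two-private w w∈S-v = ℕP.≤-trans (minimal⇒two-private S excess minimal w (p─q⊆p S ⁅ v ⁆ w∈S-v))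
                                     (p⊆q⇒∣p∣≤∣q∣ (Private-mono S w∈S-v))

  shrink : ∀ S → HasExcess E K S → ∃ λ S' → HasExcess E K S' × IsMinimal S'
  shrink S = go ∣ S ∣ S ℕP.≤-refl
    where
    go : ∀ N S → ∣ S ∣ ≤ N → HasExcess E K S → ∃ λ S' → HasExcess E K S' × IsMinimal S'
    go N S ∣S∣≤N excess with any? (λ x → x ∈? S ×-dec (∣ S - x ∣ + K ≤? ∣ F (S - x) ∣))
    ... | no ¬removable = S , excess , λ x x∈S excess' → ¬removable (x , x∈S , excess')
    go zero    S ∣S∣≤0   _ | yes (x , x∈S , _) =
      contradiction (ℕP.<-≤-trans (x∈p⇒∣p-x∣<∣p∣ x∈S) ∣S∣≤0) ℕP.n≮0
    go (suc N) S ∣S∣≤1+N _ | yes (x , x∈S , excess') =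
      go N (S - x) (ℕP.≤-pred (ℕP.<-≤-trans (x∈p⇒∣p-x∣<∣p∣ x∈S) ∣S∣≤1+N)) excess'

module Greedy {n m : ℕ} (E : Edges n m) (K : ℕ) where

  -- Each greedy step adds one vertex and at least two new edges, and the
  -- loop guard keeps the size below K.
  greedy-invariant : ∀ {S} → GreedyReach E (ℤ.+ K) S → ∣ S ∣ + ∣ S ∣ ≤ ∣ incSet E S ∣ × ∣ S ∣ ≤ K
  greedy-invariant start rewrite ∣⊥∣≡0 n = z≤n , z≤n
  greedy-invariant (step {S} v reach (ℤ.+<+ short , w , 1<gain-w) greediest) =
    doubled , ℕP.≤-trans (∣p∪⁅x⁆∣≤1+∣p∣ S v) ∣S∣<K
    where
    open ℕP.≤-Reasoning
    invariant = greedy-invariant reach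
    ∣S∣<K : ∣ S ∣ < K
    ∣S∣<K = ℕP.+-cancelˡ-< (∣ S ∣) _ _ (ℕP.≤-<-trans (proj₁ invariant) short)
    new-edges : ∣ incSet E S ∣ + gain E S v ≤ ∣ incSet E (S ∪ ⁅ v ⁆) ∣
    new-edges = ∣p∣+∣q─p∣≤∣r∣ (incSet-mono E (λ x∈S → x∈p∪q⁺ (inj₁ x∈S)))
                              (λ j∈ → ∈-incSet⁺ E (∈-inc⁻ E j∈) (x∈p∪q⁺ (inj₂ (x∈⁅x⁆ v))))
    doubled : ∣ S ∪ ⁅ v ⁆ ∣ + ∣ S ∪ ⁅ v ⁆ ∣ ≤ ∣ incSet E (S ∪ ⁅ v ⁆) ∣
    doubled = begin
      ∣ S ∪ ⁅ v ⁆ ∣ + ∣ S ∪ ⁅ v ⁆ ∣  ≤⟨ ℕP.+-mono-≤ (∣p∪⁅x⁆∣≤1+∣p∣ S v) (∣p∪⁅x⁆∣≤1+∣p∣ S v) ⟩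
      suc ∣ S ∣ + suc ∣ S ∣          ≡⟨ cong suc (ℕP.+-suc (∣ S ∣) (∣ S ∣)) ⟩
      2 + (∣ S ∣ + ∣ S ∣)            ≡⟨ ℕP.+-comm 2 _ ⟩
      ∣ S ∣ + ∣ S ∣ + 2              ≤⟨ ℕP.+-mono-≤ (proj₁ invariant) (ℕP.≤-trans 1<gain-w (greediest w)) ⟩
      ∣ incSet E S ∣ + gain E S v    ≤⟨ new-edges ⟩
      ∣ incSet E (S ∪ ⁅ v ⁆) ∣       ∎

  output⇒gain≤1 : ∀ {S} → GreedyOutput E (ℤ.+ K) S → ¬ MiniHittingSet E (ℤ.+ K) S → ∀ w → gain E S w ≤ 1
  output⇒gain≤1 {S} (reach , stopped) not-mini w
    with ℤ.+ ∣ incSet E S ∣ ℤ.<? ℤ.+ ∣ S ∣ ℤ.+ ℤ.+ K | gain E S w ≤? 1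
  ... | _           | yes gain≤1 = gain≤1
  ... | yes short   | no gain≰1  = contradiction (short , w , ℕP.≰⇒> gain≰1) stopped
  ... | no not-short | no _      =
    contradiction (ℤ.+≤+ (proj₂ (greedy-invariant reach)) , ℤP.≮⇒≥ not-short) not-mini

module Exchange {n m : ℕ} (E : Edges n m) (K : ℕ) (C C' : Subset m)
                (gain≤1 : ∀ w → ∣ inc E w ─ C ∣ ≤ 1) (¬rule2 : ¬ Rule2 E) where

  private
    F : Subset n → Subset m
    F = incSet E
    V : Subset n
    V = VOf E C C'

  Out : Fin n → Subset m
  Out u = inc E u ─ C

  same-inside : ∀ {u w j} → u ∈ V → w ∈ V → j ∈ inc E u → j ∈ C → j ∈ inc E w
  same-inside {u} {w} {j} u∈V w∈V j∈u j∈C =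
    proj₁ (x∈p∩q⁻ (inc E w) C (subst (j ∈_) (trans (VOf⇒ E u∈V) (sym (VOf⇒ E w∈V))) (x∈p∩q⁺ (j∈u , j∈C))))

  V-determined : ∀ {u w} → u ∈ V → w ∈ V → Out u ⊆ Out w → u ≡ w
  V-determined {u} {w} u∈V w∈V out⊆ with u ≟ w
  ... | yes u≡w = u≡w
  ... | no u≢w  = ⊥-elim (¬rule2 (u , w , u≢w , F[u]⊆F[w]))
    where
    F[u]⊆F[w] : inc E u ⊆ inc E w
    F[u]⊆F[w] {j} j∈u with j ∈? C
    ... | yes j∈C = same-inside u∈V w∈V j∈u j∈C
    ... | no j∉C  = p─q⊆p (inc E w) C (out⊆ (x∈p∧x∉q⇒x∈p─q j∈u j∉C))

  has-outside-edge : 1 < ∣ V ∣ → ∀ {u} → u ∈ V → Nonempty (Out u)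
  has-outside-edge 1<∣V∣ {u} u∈V with nonempty? (Out u)
  ... | yes out = out
  ... | no none = contradiction (subst (∣ V ∣ ≤_) (∣⁅x⁆∣≡1 u) (p⊆q⇒∣p∣≤∣q∣ V⊆⁅u⁆)) (ℕP.<⇒≱ 1<∣V∣)
    where
    V⊆⁅u⁆ : V ⊆ ⁅ u ⁆
    V⊆⁅u⁆ w∈V = subst (_∈ ⁅ u ⁆) (V-determined u∈V w∈V (λ j∈ → contradiction (_ , j∈) none)) (x∈⁅x⁆ u)

  -- A vertex has at most one outside edge, so it cannot meet outside edges of
  -- two distinct vertices of V.
  common-cover⇒equal : ∀ {u w j j' x} → u ∈ V → w ∈ V → j ∈ Out u → j' ∈ Out w →
                       x ∈ E j → x ∈ E j' → u ≡ w
  common-cover⇒equal {u} {w} {j} {j'} {x} u∈V w∈V j∈Out-u j'∈Out-w x∈Ej x∈Ej' =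
    V-determined u∈V w∈V λ i∈Out-u →
      subst (_∈ Out w) (sym (trans (∣p∣≤1⇒unique (Out u) (gain≤1 u) i∈Out-u j∈Out-u) j≡j')) j'∈Out-w
    where
    outside-of-x : ∀ {i} → x ∈ E i → i ∉ C → i ∈ Out x
    outside-of-x x∈Ei i∉C = x∈p∧x∉q⇒x∈p─q (∈-inc⁺ E x∈Ei) i∉C
    j≡j' : j ≡ j'
    j≡j' = ∣p∣≤1⇒unique (Out x) (gain≤1 x) (outside-of-x x∈Ej (x∈p─q⇒x∉q _ _ j∈Out-u))
                                            (outside-of-x x∈Ej' (x∈p─q⇒x∉q _ _ j'∈Out-w))

  -- If S is smaller than V, some vertex of V has an outside edge missed by S:
  -- otherwise a vertex of S meeting it would give an injection V → S.
  uncovered : ∀ S → 1 < ∣ V ∣ → ∣ S ∣ < ∣ V ∣ → ∃ λ u → u ∈ V × ∃ λ j → j ∈ Out u × j ∉ F S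
  uncovered S 1<∣V∣ ∣S∣<∣V∣ with any? (λ u → u ∈? V ×-dec ¬? (nonempty? (Out u ∩ F S)))
  ... | yes (u , u∈V , unmet) with has-outside-edge 1<∣V∣ u∈V
  ...   | j , j∈Out = u , u∈V , j , j∈Out , λ j∈F[S] → unmet (j , x∈p∩q⁺ (j∈Out , j∈F[S]))
  uncovered S 1<∣V∣ ∣S∣<∣V∣ | no all-met =
    contradiction (injection-≤ V S (λ u u∈V → proj₁ (cover u∈V))
                                   (λ u u∈V → cover∈S (proj₂ (cover u∈V))) cover-inj)
                  (ℕP.<⇒≱ ∣S∣<∣V∣)
    where
    Covers : Fin n → Fin n → Set
    Covers u x = ∃ λ j → j ∈ Out u × x ∈ E j × x ∈ S
    cover∈S : ∀ {u x} → Covers u x → x ∈ S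
    cover∈S (_ , _ , _ , x∈S) = x∈S
    cover : ∀ {u} → u ∈ V → ∃ λ x → Covers u x
    cover {u} u∈V with nonempty? (Out u ∩ F S)
    ... | no unmet = contradiction (u , u∈V , unmet) all-met
    ... | yes (j , j∈) with x∈p∩q⁻ (Out u) (F S) j∈
    ...   | j∈Out , j∈F[S] = let x , x∈Ej , x∈S = ∈-incSet⁻ E j∈F[S] in x , j , j∈Out , x∈Ej , x∈S
    cover-inj : ∀ u w u∈V w∈V → proj₁ (cover u∈V) ≡ proj₁ (cover w∈V) → u ≡ w
    cover-inj u w u∈V w∈V eq with cover u∈V | cover w∈V
    ... | x , j , j∈Out , x∈Ej , _ | x' , j' , j'∈Out , x'∈Ej' , _ =
      common-cover⇒equal u∈V w∈V j∈Out j'∈Out x∈Ej (subst (_∈ E j') (sym eq) x'∈Ej')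

  -- Trading v ∈ V for u ∈ V whose outside edge j is missed by S loses no edges:
  -- an edge of v that is lost lies outside C, and v has only one such edge.
  trade-keeps-edges : ∀ S {u v j} → u ∈ V → v ∈ V → j ∈ Out u → j ∉ F S →
                      ∣ F S ∣ ≤ ∣ F ((S - v) ∪ ⁅ u ⁆) ∣
  trade-keeps-edges S {u} {v} {j} u∈V v∈V j∈Out-u j∉F[S] =
    injection-≤ (F S) (F S') (λ i _ → redirect i) (λ i i∈ → redirect∈ i) redirect-inj
    where
    S' = (S - v) ∪ ⁅ u ⁆
    u∈S' : u ∈ S'
    u∈S' = x∈p∪q⁺ (inj₂ (x∈⁅x⁆ u))
    j∈F[S'] : j ∈ F S'
    j∈F[S'] = ∈-incSet⁺ E (∈-inc⁻ E (p─q⊆p (inc E u) C j∈Out-u)) u∈S'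
    lost⇒Out-v : ∀ {i} → i ∈ F S → i ∉ F S' → i ∈ Out v
    lost⇒Out-v {i} i∈F[S] i∉F[S'] with ∈-incSet⁻ E i∈F[S]
    ... | y , y∈Ei , y∈S with y ≟ v
    ...   | no y≢v = contradiction (∈-incSet⁺ E y∈Ei (x∈p∪q⁺ (inj₁ (x∈p∧x≢y⇒x∈p-y y∈S y≢v)))) i∉F[S']
    ...   | yes refl with i ∈? C
    ...     | yes i∈C = contradiction (∈-incSet⁺ E (∈-inc⁻ E (same-inside v∈V u∈V (∈-inc⁺ E y∈Ei) i∈C)) u∈S')
                                      i∉F[S']
    ...     | no i∉C  = x∈p∧x∉q⇒x∈p─q (∈-inc⁺ E y∈Ei) i∉C
    -- kept edges stay, the (at most one) lost edge is sent to j
    redirect : Fin m → Fin m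
    redirect i with i ∈? F S'
    ... | yes _ = i
    ... | no _  = j
    redirect∈ : ∀ i → redirect i ∈ F S'
    redirect∈ i with i ∈? F S'
    ... | yes i∈ = i∈
    ... | no _   = j∈F[S']
    redirect-inj : ∀ i i' → i ∈ F S → i' ∈ F S → redirect i ≡ redirect i' → i ≡ i'
    redirect-inj i i' i∈ i'∈ eq with i ∈? F S' | i' ∈? F S'
    ... | yes _ | yes _ = eq
    ... | yes _ | no _  = contradiction (subst (_∈ F S) eq i∈) j∉F[S]
    ... | no _  | yes _ = contradiction (subst (_∈ F S) (sym eq) i'∈) j∉F[S]
    ... | no i∉ | no i'∉ = ∣p∣≤1⇒unique (Out v) (gain≤1 v) (lost⇒Out-v i∈ i∉) (lost⇒Out-v i'∈ i'∉)

  exchange : ∀ S {v} → HasExcess E K S → ∣ S ∣ < ∣ V ∣ → v ∈ S → v ∈ V →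
             ∃ λ S' → HasExcess E K S' × v ∉ S'
  exchange S {v} excess ∣S∣<∣V∣ v∈S v∈V with uncovered S 1<∣V∣ ∣S∣<∣V∣
    where 1<∣V∣ = ℕP.≤-<-trans (ℕP.≤-trans (s≤s z≤n) (x∈p⇒∣p-x∣<∣p∣ v∈S)) ∣S∣<∣V∣
  ... | u , u∈V , j , j∈Out-u , j∉F[S] = (S - v) ∪ ⁅ u ⁆ , excess' , v∉S'
    where
    u∉S : u ∉ S
    u∉S u∈S = j∉F[S] (∈-incSet⁺ E (∈-inc⁻ E (p─q⊆p (inc E u) C j∈Out-u)) u∈S)
    v∉S' : v ∉ (S - v) ∪ ⁅ u ⁆
    v∉S' v∈S' with x∈p∪q⁻ (S - v) ⁅ u ⁆ v∈S'
    ... | inj₁ v∈S-v = x∈p─q⇒x∉q S ⁅ v ⁆ v∈S-v (x∈⁅x⁆ v)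
    ... | inj₂ v∈⁅u⁆ = u∉S (subst (_∈ S) (x∈⁅y⁆⇒x≡y u v∈⁅u⁆) v∈S)
    smaller : ∣ (S - v) ∪ ⁅ u ⁆ ∣ ≤ ∣ S ∣
    smaller = ℕP.≤-trans (∣p∪⁅x⁆∣≤1+∣p∣ (S - v) u) (ℕP.≤-reflexive (sym (∣p∣≡1+∣p-x∣ v∈S)))
    excess' : HasExcess E K ((S - v) ∪ ⁅ u ⁆)
    excess' = ℕP.≤-trans (ℕP.+-monoˡ-≤ K smaller)
                (ℕP.≤-trans excess (trade-keeps-edges S u∈V v∈V j∈Out-u j∉F[S]))

-- Under the hypotheses of the exchange, every set of excess K < |V(C')| can be
-- replaced by one avoiding a prescribed v ∈ V(C'): shrink it to a minimal set,
-- which has at most K vertices, and exchange v if it is still present.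
excess-avoiding : ∀ {n m} (E : Edges n m) K (C C' : Subset m) →
                  (∀ w → ∣ inc E w ─ C ∣ ≤ 1) → ¬ Rule2 E → K < ∣ VOf E C C' ∣ →
                  ∀ {v} → v ∈ VOf E C C' → ∀ S → HasExcess E K S →
                  ∃ λ S' → HasExcess E K S' × v ∉ S'
excess-avoiding E K C C' gain≤1 ¬rule2 K<∣V∣ {v} v∈V S excess
  with Minimal.shrink E K S excess
... | S₀ , excess₀ , minimal₀ with v ∈? S₀
...   | no v∉S₀  = S₀ , excess₀ , v∉S₀
...   | yes v∈S₀ = Exchange.exchange E K C C' gain≤1 ¬rule2 S₀ excess₀
                     (ℕP.≤-<-trans (Minimal.minimal⇒size≤K E K S₀ excess₀ minimal₀ v∈S₀) K<∣V∣) v∈S₀ v∈V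

module Deletion {n m : ℕ} (E : Edges (suc n) m) (v : Fin (suc n)) where

  -- The trace of S on V ∖ {v}; note that deleteV E v j = restrict (E j).
  restrict : Subset (suc n) → Subset n
  restrict S = tabulate λ i → lookup S (punchIn v i)

  ∈-restrict⁺ : ∀ {S i} → punchIn v i ∈ S → i ∈ restrict S
  ∈-restrict⁺ {S} {i} p = ∈-tabulate⁺ _ ([]=⇒lookup p)

  ∈-restrict⁻ : ∀ {S i} → i ∈ restrict S → punchIn v i ∈ S
  ∈-restrict⁻ {S} {i} i∈ = lookup⇒[]= (punchIn v i) S (∈-tabulate⁻ _ i∈)

  ∣restrict∣≤ : ∀ S → ∣ restrict S ∣ ≤ ∣ S ∣
  ∣restrict∣≤ S = injection-≤ (restrict S) S (λ i _ → punchIn v i) (λ i → ∈-restrict⁻)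
                              (λ i i' _ _ → punchIn-injective v i i')

  -- A set of H - v, read in H by declaring v absent.
  ∈-insertAt : ∀ {T i} → i ∈ T → punchIn v i ∈ insertAt T v outside
  ∈-insertAt {T} {i} i∈T =
    lookup⇒[]= (punchIn v i) _ (trans (insertAt-punchIn T v outside i) ([]=⇒lookup i∈T))

  lift-yes : ∀ {k} → HSYes (deleteV E v) k → HSYes E k
  lift-yes (T , hit , ∣T∣≤m-k) =
    insertAt T v outside , lift-hit , subst (λ c → ℤ.+ c ℤ.≤ _) (sym (∣insertAt-outside∣ T v)) ∣T∣≤m-k
    where
    lift-hit : HittingSet E (insertAt T v outside)
    lift-hit j with hit j
    ... | i , i∈Ej-v∩T with x∈p∩q⁻ (deleteV E v j) T i∈Ej-v∩T
    ...   | i∈Ej-v , i∈T = punchIn v i , x∈p∩q⁺ (∈-restrict⁻ i∈Ej-v , ∈-insertAt i∈T)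

  vanishing-edge : ∀ {j} → ¬ Nonempty (deleteV E v j) → E j ⊆ ⁅ v ⁆
  vanishing-edge {j} empty {x} x∈Ej with v ≟ x
  ... | yes refl = x∈⁅x⁆ v
  ... | no v≢x   = contradiction
    (punchOut v≢x , ∈-restrict⁺ (subst (_∈ E j) (sym (punchIn-punchOut v≢x)) x∈Ej)) empty

  -- Under Rules 1 and 3 all edges of H - v are nonempty: an edge {v} would be
  -- contained in another edge through v, or be the only edge of v.
  deleted-edges-nonempty : IsHypergraph E → ¬ Rule1 E → ¬ Rule3 E → ∀ j → Nonempty (deleteV E v j)
  deleted-edges-nonempty (_ , edges-nonempty) ¬rule1 ¬rule3 j with nonempty? (deleteV E v j)
  ... | yes nonempty = nonempty
  ... | no empty with any? (λ j' → v ∈? E j' ×-dec ¬? (j ≟ j'))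
  ...   | yes (j' , v∈Ej' , j≢j') =
    ⊥-elim (¬rule1 (j , j' , j≢j' , λ x∈Ej → subst (_∈ E j') (sym (x∈⁅y⁆⇒x≡y v (Ej⊆⁅v⁆ x∈Ej))) v∈Ej'))
    where Ej⊆⁅v⁆ = vanishing-edge empty
  ...   | no only-j =
    ⊥-elim (¬rule3 (v , j , ⊆-antisym F[v]⊆⁅j⁆ ⁅j⁆⊆F[v] , ⊆-antisym (vanishing-edge empty) ⁅v⁆⊆Ej))
    where
    v∈Ej : v ∈ E j
    v∈Ej = let x , x∈Ej = edges-nonempty j in subst (_∈ E j) (x∈⁅y⁆⇒x≡y v (vanishing-edge empty x∈Ej)) x∈Ej
    ⁅v⁆⊆Ej : ⁅ v ⁆ ⊆ E j
    ⁅v⁆⊆Ej x∈⁅v⁆ = subst (_∈ E j) (sym (x∈⁅y⁆⇒x≡y v x∈⁅v⁆)) v∈Ej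
    ⁅j⁆⊆F[v] : ⁅ j ⁆ ⊆ inc E v
    ⁅j⁆⊆F[v] i∈⁅j⁆ = subst (_∈ inc E v) (sym (x∈⁅y⁆⇒x≡y j i∈⁅j⁆)) (∈-inc⁺ E v∈Ej)
    F[v]⊆⁅j⁆ : inc E v ⊆ ⁅ j ⁆
    F[v]⊆⁅j⁆ {i} i∈F[v] with j ≟ i
    ... | yes refl = x∈⁅x⁆ j
    ... | no j≢i   = contradiction (i , ∈-inc⁻ E i∈F[v] , j≢i) only-j

  restrict-excess : ∀ {K S} → v ∉ S → HasExcess E K S → HasExcess (deleteV E v) K (restrict S)
  restrict-excess {K} {S} v∉S excess =
    ℕP.≤-trans (ℕP.+-monoˡ-≤ K (∣restrict∣≤ S)) (ℕP.≤-trans excess (p⊆q⇒∣p∣≤∣q∣ F[S]⊆))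
    where
    F[S]⊆ : incSet E S ⊆ incSet (deleteV E v) (restrict S)
    F[S]⊆ {j} j∈ with ∈-incSet⁻ E j∈
    ... | x , x∈Ej , x∈S with v ≟ x
    ...   | yes refl = contradiction x∈S v∉S
    ...   | no v≢x   = ∈-incSet⁺ (deleteV E v) (∈-restrict⁺ (subst (_∈ E j) x≡ x∈Ej))
                                               (∈-restrict⁺ (subst (_∈ S) x≡ x∈S))
      where x≡ = sym (punchIn-punchOut v≢x)

-- For k = K ≥ 0: a hitting set of H gives a set of excess K, which can be made
-- to avoid v and then restricts to H - v.
yes⇒deleted-yes : ∀ {n m} (E : Edges (suc n) m) K (C C' : Subset m) {v} →
                  (∀ j → Nonempty (deleteV E v j)) → (∀ w → ∣ inc E w ─ C ∣ ≤ 1) → ¬ Rule2 E →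
                  K < ∣ VOf E C C' ∣ → v ∈ VOf E C C' → HSYes E (ℤ.+ K) → HSYes (deleteV E v) (ℤ.+ K)
yes⇒deleted-yes {n} {m} E K C C' {v} nonempty gain≤1 ¬rule2 K<∣V∣ v∈V (T , hit , ∣T∣≤m-K)
  with excess-avoiding E K C C' gain≤1 ¬rule2 K<∣V∣ v∈V T
         (hitting⇒excess E K hit (Equivalence.to (budget⇔ ∣ T ∣ m K) ∣T∣≤m-K))
... | S , excess , v∉S with excess⇒hitting (deleteV E v) nonempty K (Deletion.restrict-excess E v v∉S excess)
...   | T' , hit' , ∣T'∣+K≤m = T' , hit' , Equivalence.from (budget⇔ ∣ T' ∣ m K) ∣T'∣+K≤m

-- For k < 0 any hypergraph with nonempty edges is a Yes-instance: the empty set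
-- has excess 0, so H is a Yes-instance for k = 0 already.
negative-yes : ∀ {n m} (E : Edges n m) → (∀ j → Nonempty (E j)) → ∀ K → HSYes E -[1+ K ]
negative-yes {n} {m} E nonempty K with excess⇒hitting E nonempty {⊥} 0 ⊥-has-excess-0
  where ⊥-has-excess-0 = subst (λ c → c + 0 ≤ ∣ incSet E ⊥ ∣) (sym (∣⊥∣≡0 n)) z≤n
... | T , hit , ∣T∣+0≤m =
  HSYes-antitone E {ℤ.+ 0} (T , hit , Equivalence.from (budget⇔ ∣ T ∣ m 0) ∣T∣+0≤m) ℤ.-≤+

lemma5 : ∀ {n m} (E : Edges (suc n) m) (k : ℤ) →
    IsHypergraph E → ¬ Rule1 E → ¬ Rule2 E → ¬ Rule3 E →
    (S* : Subset (suc n)) → GreedyOutput E k S* → ¬ MiniHittingSet E k S* →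
    (C' : Subset m) → C' ⊆ incSet E S* → k ℤ.< ℤ.+ ∣ VOf E (incSet E S*) C' ∣ →
    (v : Fin (suc n)) → v ∈ VOf E (incSet E S*) C' →
    HSYes (deleteV E v) k ⇔ HSYes E k
lemma5 E (ℤ.+ K) isH ¬rule1 ¬rule2 ¬rule3 S* output not-mini C' _ (ℤ.+<+ K<∣V∣) v v∈V =
  mk⇔ (Deletion.lift-yes E v {ℤ.+ K})
      (yes⇒deleted-yes E K (incSet E S*) C' (Deletion.deleted-edges-nonempty E v isH ¬rule1 ¬rule3)
                       (Greedy.output⇒gain≤1 E K output not-mini) ¬rule2 K<∣V∣ v∈V)
lemma5 E -[1+ K ] isH ¬rule1 _ ¬rule3 _ _ _ _ _ _ v _ =
  mk⇔ (Deletion.lift-yes E v { -[1+ K ]})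
      (λ _ → negative-yes (deleteV E v) (Deletion.deleted-edges-nonempty E v isH ¬rule1 ¬rule3) K)
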